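{- There are a function $g:\omega\to\omega$ and a set $B\subseteq\omega$ such that $B\le_{\mathrm{mf}} g$ but $B\not\le_{\mathrm{cf}} g$, and hence $B\not\le_{\mathrm{ubfb}} g$.
   Context: Sets are identified with characteristic functions. A mod-finite description of $g$ is a total function agreeing with $g$ on all but finitely many arguments; $h\le_{\mathrm{mf}} g$ means there is a Turing functional $\Phi$ such that $\Phi^f$ is a mod-finite description of $h$ for every mod-finite description $f$ of $g$. A cofinite description of $g$ is a partial function $f$ with cofinite domain such that $f(n)=g(n)$ for all $n\in\mathrm{dom} f$. An enumeration operator is a c.e. set $W$ of pairs $(F,k)$, $F$ finite, with $W^Y=\{k:\exists(F,k)\in W,\,F\subseteq Y\}$. $h\le_{\mathrm{cf}} g$ means there is an enumeration operator $W$ such that for every cofinite description $f$ of $g$, $W^{\mathrm{gra}(f)}$ is the graph of a cofinite description of $h$. $h\le_{\mathrm{ubfb}} g$ means $h=\Phi^g$ for some Turing functional $\Phi$ such that the least argument at which $g$ is queried during the computation of $\Phi^g(n)$ tends to infinity with $n$. -}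

module Defs where

open import Data.Nat using (ℕ; zero; suc; _+_; _*_; _^_; _≤_)
open import Data.Nat.Properties using ()
open import Data.Bool using (Bool; true; false)
open import Data.List using (List; []; _∷_; _++_; [_])
open import Data.List.Relation.Unary.All using (All)
open import Data.Maybe using (Maybe; just; nothing)
open import Data.Product using (Σ; _×_; _,_; ∃; ∃-syntax)
open import Relation.Binary.PropositionalEquality using (_≡_)
open import Function.Bundles using (_⇔_)

-- A concrete model of oracle computation: codes for (oracle) partial
-- recursive functions.  Turing functionals = codes; c.e. sets = domains
-- of codes run with no meaningful oracle.

data Code : Set where
  zer  : Code
  succ : Code
  proj : ℕ → Code
  comp : Code → List Code → Code
  prec : Code → Code → Code
  mu   : Code → Code
  orc  : Code

nth : ℕ → List ℕ → Maybe ℕ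
nth _       []       = nothing
nth zero    (x ∷ xs) = just x
nth (suc i) (x ∷ xs) = nth i xs

-- eval fuel c f xs = just (value , list of oracle queries made)
mutual
  eval : ℕ → Code → (ℕ → ℕ) → List ℕ → Maybe (ℕ × List ℕ)
  eval zero    _          f xs       = nothing
  eval (suc k) zer        f xs       = just (0 , [])
  eval (suc k) succ       f []       = nothing
  eval (suc k) succ       f (x ∷ xs) = just (suc x , [])
  eval (suc k) (proj i)   f xs with nth i xs
  ... | nothing = nothing
  ... | just v  = just (v , [])
  eval (suc k) (comp c ds) f xs with evalL k ds f xs
  ... | nothing = nothing
  ... | just (ys , q₁) with eval k c f ys
  ...   | nothing = nothing
  ...   | just (m , q₂) = just (m , q₁ ++ q₂)
  eval (suc k) (prec b s) f []       = nothing
  eval (suc k) (prec b s) f (x ∷ xs) = precL k b s f x xs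
  eval (suc k) (mu c)     f xs       = muL k c f 0 xs
  eval (suc k) orc        f []       = nothing
  eval (suc k) orc        f (x ∷ xs) = just (f x , [ x ])

  evalL : ℕ → List Code → (ℕ → ℕ) → List ℕ → Maybe (List ℕ × List ℕ)
  evalL k []       f xs = just ([] , [])
  evalL k (d ∷ ds) f xs with eval k d f xs
  ... | nothing = nothing
  ... | just (v , q₁) with evalL k ds f xs
  ...   | nothing = nothing
  ...   | just (vs , q₂) = just (v ∷ vs , q₁ ++ q₂)

  precL : ℕ → Code → Code → (ℕ → ℕ) → ℕ → List ℕ → Maybe (ℕ × List ℕ)
  precL zero    b s f y       xs = nothing
  precL (suc k) b s f zero    xs = eval k b f xs
  precL (suc k) b s f (suc y) xs with precL k b s f y xs
  ... | nothing = nothing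
  ... | just (r , q₁) with eval k s f (y ∷ r ∷ xs)
  ...   | nothing = nothing
  ...   | just (m , q₂) = just (m , q₁ ++ q₂)

  muL : ℕ → Code → (ℕ → ℕ) → ℕ → List ℕ → Maybe (ℕ × List ℕ)
  muL zero    c f i xs = nothing
  muL (suc k) c f i xs with eval k c f (i ∷ xs)
  ... | nothing = nothing
  ... | just (zero , q)  = just (i , q)
  ... | just (suc _ , q₁) with muL k c f (suc i) xs
  ...   | nothing = nothing
  ...   | just (m , q₂) = just (m , q₁ ++ q₂)

RunsTo : Code → (ℕ → ℕ) → ℕ → ℕ → List ℕ → Set
RunsTo Φ f n m qs = ∃[ t ] eval t Φ f [ n ] ≡ just (m , qs)

_^_⟨_⟩≃_ : Code → (ℕ → ℕ) → ℕ → ℕ → Set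
Φ ^ f ⟨ n ⟩≃ m = ∃[ qs ] RunsTo Φ f n m qs

χ : (ℕ → Bool) → ℕ → ℕ
χ B n with B n
... | true  = 1
... | false = 0

tri : ℕ → ℕ
tri zero    = zero
tri (suc k) = suc k + tri k

⟨_,_⟩ : ℕ → ℕ → ℕ
⟨ n , m ⟩ = tri (n + m) + m

-- Canonical index of finite sets: i ∈ D_x iff bit i of x is 1
half : ℕ → ℕ
half zero          = zero
half (suc zero)    = zero
half (suc (suc x)) = suc (half x)

odd : ℕ → Bool
odd zero          = false
odd (suc zero)    = true
odd (suc (suc x)) = odd x

bit : ℕ → ℕ → Bool
bit zero    x = odd x
bit (suc i) x = bit i (half x)

_∈D_ : ℕ → ℕ → Set
i ∈D x = bit i x ≡ true

-- Cofinite subset of ℕ (complement finite, i.e. bounded)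
Cofinite : (ℕ → Set) → Set
Cofinite D = ∃[ N ] (∀ n → N ≤ n → D n)

ModFinDesc : (ℕ → ℕ) → (ℕ → ℕ) → Set
ModFinDesc f g = ∃[ N ] (∀ n → N ≤ n → f n ≡ g n)

TotalModFinDescOf : Code → (ℕ → ℕ) → (ℕ → ℕ) → Set
TotalModFinDescOf Φ f h =
  (∀ n → ∃[ m ] (Φ ^ f ⟨ n ⟩≃ m)) × (∃[ N ] (∀ n → N ≤ n → Φ ^ f ⟨ n ⟩≃ h n))

_≤mf_ : (ℕ → ℕ) → (ℕ → ℕ) → Set
h ≤mf g = ∃[ Φ ] (∀ f → ModFinDesc f g → TotalModFinDescOf Φ f h)

-- Cofinite reducibility
-- A cofinite description of g is determined by its cofinite domain D;
-- its graph (as a set of coded pairs) is GraphOn g D.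

GraphOn : (ℕ → ℕ) → (ℕ → Set) → ℕ → Set
GraphOn g D k = ∃[ n ] (D n × k ≡ ⟨ n , g n ⟩)

-- c.e. set W_e = domain of e (oracle irrelevant: constantly 0)
InCE : Code → ℕ → Set
InCE e x = ∃[ m ] (e ^ (λ _ → 0) ⟨ x ⟩≃ m)

-- enumeration operator given by the c.e. set of pairs ⟨ F-index , k ⟩
EnumOp : Code → (ℕ → Set) → ℕ → Set
EnumOp W Y k = ∃[ x ] (InCE W ⟨ x , k ⟩ × (∀ i → i ∈D x → Y i))

_≤cf_ : (ℕ → ℕ) → (ℕ → ℕ) → Set₁
h ≤cf g = ∃[ W ] (∀ (D : ℕ → Set) → Cofinite D →
  ∃[ D' ] (Cofinite D' × (∀ k → EnumOp W (GraphOn g D) k ⇔ GraphOn h D' k)))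

_≤ubfb_ : (ℕ → ℕ) → (ℕ → ℕ) → Set
h ≤ubfb g = ∃[ Φ ] ((∀ n → Φ ^ g ⟨ n ⟩≃ h n) ×
  (∀ M → ∃[ N ] (∀ n → N ≤ n → ∀ m qs → RunsTo Φ g n m qs → All (M ≤_) qs)))

-- The function G is built by finite extension. A value v codes the number half v together with the
-- bit v ∸ 2·half v, and B n is the bit of the first value of G coding n; a search for that first
-- position is not disturbed by finitely many wrong values once n exceeds them, so B ≤mf G.
-- At stage e, against the code W numbered e, excluded middle decides whether some extension of the
-- current segment of length L lets W enumerate a pair ⟨ n , b ⟩, n fresh, from the graph without
-- position L. If so, G follows that extension but puts at L a first code for n with the bit ≠ b, so
-- W errs on the cofinite description missing L; if not, W already fails to enumerate the cofinitely
-- many pairs ⟨ n , B n ⟩ from that description. Computations with all queries above L are defeated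
-- the same way. Each stage also codes 0, …, e again, so every mod-finite description codes every n.

module Submission where

open import Defs
open import Level using (0ℓ)
open import Axiom.ExcludedMiddle using (ExcludedMiddle)
open import Data.Bool using (Bool; true; false)
open import Data.Empty using (⊥-elim)
open import Data.List using (List; []; _∷_; _++_; [_])
open import Data.List.Extrema.Nat using (max; xs≤max)
open import Data.List.Relation.Unary.All as All using (All; []; _∷_)
open import Data.List.Relation.Unary.All.Properties using (++⁻)
open import Data.Maybe using (Maybe; just; nothing)
open import Data.Maybe.Properties using (just-injective)
open import Data.Nat using (ℕ; zero; suc; pred; _+_; _∸_; _⊔_; _≤_; _<_; _≟_; _≤?_; _<?_; _≡ᵇ_; z≤n; z<s; s≤s)
open import Data.Nat.Properties
open import Data.Product using (Σ; _×_; _,_; proj₁; proj₂; ∃; ∃-syntax)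
open import Data.Sum using (inj₁; inj₂)
open import Function.Bundles using (_⇔_; Equivalence)
open import Relation.Binary.Definitions using (tri<; tri≈; tri>)
open import Relation.Binary.PropositionalEquality using (_≡_; _≢_; refl; sym; trans; cong; cong₂; subst; module ≡-Reasoning)
open import Relation.Nullary using (¬_; yes; no; _×-dec_)
open import Relation.Nullary.Decidable using (map′)
open import Relation.Unary using (Decidable)

nothing≢just : ∀ {A : Set} {x : A} → nothing ≢ just x
nothing≢just ()

AgreeOn : (ℕ → ℕ) → (ℕ → ℕ) → List ℕ → Set
AgreeOn f f' = All (λ q → f q ≡ f' q)

comp-intro : ∀ k c ds f xs {ys q₁ m q₂} → evalL k ds f xs ≡ just (ys , q₁) →
  eval k c f ys ≡ just (m , q₂) → eval (suc k) (comp c ds) f xs ≡ just (m , q₁ ++ q₂)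
comp-intro k c ds f xs e₁ e₂ rewrite e₁ | e₂ = refl

cons-intro : ∀ k d ds f xs {v q₁ vs q₂} → eval k d f xs ≡ just (v , q₁) →
  evalL k ds f xs ≡ just (vs , q₂) → evalL k (d ∷ ds) f xs ≡ just (v ∷ vs , q₁ ++ q₂)
cons-intro k d ds f xs e₁ e₂ rewrite e₁ | e₂ = refl

prec-intro : ∀ k b s f y xs {r q₁ m q₂} → precL k b s f y xs ≡ just (r , q₁) →
  eval k s f (y ∷ r ∷ xs) ≡ just (m , q₂) → precL (suc k) b s f (suc y) xs ≡ just (m , q₁ ++ q₂)
prec-intro k b s f y xs e₁ e₂ rewrite e₁ | e₂ = refl

mu-here-intro : ∀ k c f i xs {q} → eval k c f (i ∷ xs) ≡ just (0 , q) → muL (suc k) c f i xs ≡ just (i , q)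
mu-here-intro k c f i xs e rewrite e = refl

mu-next-intro : ∀ k c f i xs {j q₁ m q₂} → eval k c f (i ∷ xs) ≡ just (suc j , q₁) →
  muL k c f (suc i) xs ≡ just (m , q₂) → muL (suc k) c f i xs ≡ just (m , q₁ ++ q₂)
mu-next-intro k c f i xs e₁ e₂ rewrite e₁ | e₂ = refl

mutual
  eval-stable : ∀ {k k'} c f f' xs {m qs} → k ≤ k' → AgreeOn f f' qs →
    eval k c f xs ≡ just (m , qs) → eval k' c f' xs ≡ just (m , qs)
  eval-stable {zero} _ _ _ _ _ _ ()
  eval-stable zer f f' xs (s≤s _) _ e = e
  eval-stable succ f f' [] (s≤s _) _ ()
  eval-stable succ f f' (x ∷ xs) (s≤s _) _ e = e
  eval-stable (proj i) f f' xs (s≤s _) _ e with nth i xs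
  ... | nothing = ⊥-elim (nothing≢just e)
  ... | just v = e
  eval-stable {suc k} {suc k'} (comp c ds) f f' xs (s≤s k≤k') a e with evalL k ds f xs in e₁
  ... | nothing = ⊥-elim (nothing≢just e)
  ... | just (ys , q₁) with eval k c f ys in e₂
  ...   | nothing = ⊥-elim (nothing≢just e)
  ...   | just (m , q₂) with refl ← e with a₁ , a₂ ← ++⁻ q₁ a =
    comp-intro k' c ds f' xs (evalL-stable ds f f' xs k≤k' a₁ e₁) (eval-stable c f f' ys k≤k' a₂ e₂)
  eval-stable (prec b s) f f' [] (s≤s _) _ ()
  eval-stable (prec b s) f f' (x ∷ xs) (s≤s k≤k') a e = precL-stable b s f f' x xs k≤k' a e
  eval-stable (mu c) f f' xs (s≤s k≤k') a e = muL-stable c f f' 0 xs k≤k' a e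
  eval-stable orc f f' [] (s≤s _) _ ()
  eval-stable orc f f' (x ∷ xs) (s≤s _) (fx≡f'x ∷ []) refl = cong (λ v → just (v , [ x ])) (sym fx≡f'x)

  evalL-stable : ∀ {k k'} ds f f' xs {vs qs} → k ≤ k' → AgreeOn f f' qs →
    evalL k ds f xs ≡ just (vs , qs) → evalL k' ds f' xs ≡ just (vs , qs)
  evalL-stable [] f f' xs _ _ e = e
  evalL-stable {k} {k'} (d ∷ ds) f f' xs k≤k' a e with eval k d f xs in e₁
  ... | nothing = ⊥-elim (nothing≢just e)
  ... | just (v , q₁) with evalL k ds f xs in e₂
  ...   | nothing = ⊥-elim (nothing≢just e)
  ...   | just (vs , q₂) with refl ← e with a₁ , a₂ ← ++⁻ q₁ a =
    cons-intro k' d ds f' xs (eval-stable d f f' xs k≤k' a₁ e₁) (evalL-stable ds f f' xs k≤k' a₂ e₂)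

  precL-stable : ∀ {k k'} b s f f' y xs {m qs} → k ≤ k' → AgreeOn f f' qs →
    precL k b s f y xs ≡ just (m , qs) → precL k' b s f' y xs ≡ just (m , qs)
  precL-stable {zero} _ _ _ _ _ _ _ _ ()
  precL-stable b s f f' zero xs (s≤s k≤k') a e = eval-stable b f f' xs k≤k' a e
  precL-stable {suc k} {suc k'} b s f f' (suc y) xs (s≤s k≤k') a e with precL k b s f y xs in e₁
  ... | nothing = ⊥-elim (nothing≢just e)
  ... | just (r , q₁) with eval k s f (y ∷ r ∷ xs) in e₂
  ...   | nothing = ⊥-elim (nothing≢just e)
  ...   | just (m , q₂) with refl ← e with a₁ , a₂ ← ++⁻ q₁ a =
    prec-intro k' b s f' y xs (precL-stable b s f f' y xs k≤k' a₁ e₁) (eval-stable s f f' _ k≤k' a₂ e₂)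

  muL-stable : ∀ {k k'} c f f' i xs {m qs} → k ≤ k' → AgreeOn f f' qs →
    muL k c f i xs ≡ just (m , qs) → muL k' c f' i xs ≡ just (m , qs)
  muL-stable {zero} _ _ _ _ _ _ _ ()
  muL-stable {suc k} {suc k'} c f f' i xs (s≤s k≤k') a e with eval k c f (i ∷ xs) in e₁
  ... | nothing = ⊥-elim (nothing≢just e)
  ... | just (zero , q) with refl ← e = mu-here-intro k' c f' i xs (eval-stable c f f' _ k≤k' a e₁)
  ... | just (suc j , q₁) with muL k c f (suc i) xs in e₂
  ...   | nothing = ⊥-elim (nothing≢just e)
  ...   | just (m , q₂) with refl ← e with a₁ , a₂ ← ++⁻ q₁ a =
    mu-next-intro k' c f' i xs (eval-stable c f f' _ k≤k' a₁ e₁) (muL-stable c f f' (suc i) xs k≤k' a₂ e₂)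

agreeOn-refl : ∀ {f} qs → AgreeOn f f qs
agreeOn-refl = All.universal (λ _ → refl)

eval-use : ∀ {k} c f f' xs {m qs} → AgreeOn f f' qs →
  eval k c f xs ≡ just (m , qs) → eval k c f' xs ≡ just (m , qs)
eval-use {k} c f f' xs = eval-stable {k} c f f' xs ≤-refl

eval-deterministic : ∀ {k k'} c f xs {r r'} → eval k c f xs ≡ just r → eval k' c f xs ≡ just r' → r ≡ r'
eval-deterministic {k} {k'} c f xs {m , qs} {m' , qs'} e e' = just-injective (trans
  (sym (eval-stable c f f xs (m≤m⊔n k k') (agreeOn-refl qs) e)) (eval-stable c f f xs (m≤n⊔m k k') (agreeOn-refl qs') e'))

record Eval (c : Code) (f : ℕ → ℕ) (xs : List ℕ) (v : ℕ) : Set where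
  constructor converges
  field
    fuel    : ℕ
    queries : List ℕ
    halts   : eval fuel c f xs ≡ just (v , queries)

record EvalL (ds : List Code) (f : ℕ → ℕ) (xs vs : List ℕ) : Set where
  constructor converges
  field
    fuel    : ℕ
    queries : List ℕ
    halts   : evalL fuel ds f xs ≡ just (vs , queries)

record PrecL (b s : Code) (f : ℕ → ℕ) (y : ℕ) (xs : List ℕ) (v : ℕ) : Set where
  constructor converges
  field
    fuel    : ℕ
    queries : List ℕ
    halts   : precL fuel b s f y xs ≡ just (v , queries)

record MuL (c : Code) (f : ℕ → ℕ) (i : ℕ) (xs : List ℕ) (v : ℕ) : Set where
  constructor converges
  field
    fuel    : ℕ
    queries : List ℕ
    halts   : muL fuel c f i xs ≡ just (v , queries)

eval⇒computes : ∀ {Φ f n m} → Eval Φ f [ n ] m → Φ ^ f ⟨ n ⟩≃ m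
eval⇒computes (converges k qs e) = qs , k , e

module _ {f : ℕ → ℕ} where

  zer⇓ : ∀ {xs} → Eval zer f xs 0
  zer⇓ = converges 1 [] refl

  succ⇓ : ∀ {x xs} → Eval succ f (x ∷ xs) (suc x)
  succ⇓ = converges 1 [] refl

  proj⇓ : ∀ i {xs v} → nth i xs ≡ just v → Eval (proj i) f xs v
  proj⇓ i {xs} {v} e = converges 1 [] halts
    where
    halts : eval 1 (proj i) f xs ≡ just (v , [])
    halts rewrite e = refl

  orc⇓ : ∀ {x xs} → Eval orc f (x ∷ xs) (f x)
  orc⇓ = converges 1 _ refl

  nil⇓ : ∀ {xs} → EvalL [] f xs []
  nil⇓ = converges 0 [] refl

  cons⇓ : ∀ {d ds xs v vs} → Eval d f xs v → EvalL ds f xs vs → EvalL (d ∷ ds) f xs (v ∷ vs)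
  cons⇓ {d} {ds} {xs} (converges k₁ q₁ e₁) (converges k₂ q₂ e₂) = converges (k₁ ⊔ k₂) (q₁ ++ q₂)
    (cons-intro (k₁ ⊔ k₂) d ds f xs (eval-stable d f f xs (m≤m⊔n k₁ k₂) (agreeOn-refl q₁) e₁)
      (evalL-stable ds f f xs (m≤n⊔m k₁ k₂) (agreeOn-refl q₂) e₂))

  comp⇓ : ∀ {c ds xs ys v} → EvalL ds f xs ys → Eval c f ys v → Eval (comp c ds) f xs v
  comp⇓ {c} {ds} {xs} {ys} (converges k₁ q₁ e₁) (converges k₂ q₂ e₂) = converges (suc (k₁ ⊔ k₂)) (q₁ ++ q₂)
    (comp-intro (k₁ ⊔ k₂) c ds f xs (evalL-stable ds f f xs (m≤m⊔n k₁ k₂) (agreeOn-refl q₁) e₁)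
      (eval-stable c f f ys (m≤n⊔m k₁ k₂) (agreeOn-refl q₂) e₂))

  prec⇓ : ∀ {b s y xs v} → PrecL b s f y xs v → Eval (prec b s) f (y ∷ xs) v
  prec⇓ (converges k q e) = converges (suc k) q e

  prec-zero⇓ : ∀ {b s xs v} → Eval b f xs v → PrecL b s f zero xs v
  prec-zero⇓ (converges k q e) = converges (suc k) q e

  prec-suc⇓ : ∀ {b s y xs r v} → PrecL b s f y xs r → Eval s f (y ∷ r ∷ xs) v → PrecL b s f (suc y) xs v
  prec-suc⇓ {b} {s} {y} {xs} {r} (converges k₁ q₁ e₁) (converges k₂ q₂ e₂) = converges (suc (k₁ ⊔ k₂)) (q₁ ++ q₂)
    (prec-intro (k₁ ⊔ k₂) b s f y xs (precL-stable b s f f y xs (m≤m⊔n k₁ k₂) (agreeOn-refl q₁) e₁)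
      (eval-stable s f f (y ∷ r ∷ xs) (m≤n⊔m k₁ k₂) (agreeOn-refl q₂) e₂))

  mu⇓ : ∀ {c xs v} → MuL c f 0 xs v → Eval (mu c) f xs v
  mu⇓ (converges k q e) = converges (suc k) q e

  mu-here⇓ : ∀ {c i xs} → Eval c f (i ∷ xs) 0 → MuL c f i xs i
  mu-here⇓ {c} {i} {xs} (converges k q e) = converges (suc k) q (mu-here-intro k c f i xs e)

  mu-next⇓ : ∀ {c i xs v m} → v ≢ 0 → Eval c f (i ∷ xs) v → MuL c f (suc i) xs m → MuL c f i xs m
  mu-next⇓ {v = zero} v≢0 = ⊥-elim (v≢0 refl)
  mu-next⇓ {c} {i} {xs} {suc j} _ (converges k₁ q₁ e₁) (converges k₂ q₂ e₂) = converges (suc (k₁ ⊔ k₂)) (q₁ ++ q₂)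
    (mu-next-intro (k₁ ⊔ k₂) c f i xs (eval-stable c f f (i ∷ xs) (m≤m⊔n k₁ k₂) (agreeOn-refl q₁) e₁)
      (muL-stable c f f (suc i) xs (m≤n⊔m k₁ k₂) (agreeOn-refl q₂) e₂))

  search⇓ : ∀ {c xs} (test : ℕ → ℕ) → (∀ i → Eval c f (i ∷ xs) (test i)) →
    ∀ L → (∀ p → p < L → test p ≢ 0) → test L ≡ 0 → Eval (mu c) f xs L
  search⇓ {c} {xs} test runs L below hit = mu⇓ (from 0 L (λ p _ → below p) hit)
    where
    from : ∀ i j → (∀ p → i ≤ p → p < i + j → test p ≢ 0) → test (i + j) ≡ 0 → MuL c f i xs (i + j)
    from i zero _ z rewrite +-identityʳ i = mu-here⇓ (subst (Eval c f (i ∷ xs)) z (runs i))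
    from i (suc j) skip z = mu-next⇓ (skip i ≤-refl (m<m+n i z<s)) (runs i)
      (subst (MuL c f (suc i) xs) (sym (+-suc i j))
        (from (suc i) j (λ p i<p p<1+i+j → skip p (<⇒≤ i<p) (subst (p <_) (sym (+-suc i j)) p<1+i+j))
          (subst (λ p → test p ≡ 0) (+-suc i j) z)))

predCode : Code
predCode = prec zer (proj 0)

addCode : Code
addCode = prec (proj 0) (comp succ [ proj 1 ])

monusCode : Code
monusCode = prec (proj 0) (comp predCode [ proj 1 ])

module _ {f : ℕ → ℕ} where

  pred⇓ : ∀ x → Eval predCode f [ x ] (pred x)
  pred⇓ x = prec⇓ (loop x)
    where
    loop : ∀ y → PrecL zer (proj 0) f y [] (pred y)
    loop zero = prec-zero⇓ zer⇓
    loop (suc y) = prec-suc⇓ (loop y) (proj⇓ 0 refl)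

  add⇓ : ∀ x y → Eval addCode f (x ∷ y ∷ []) (x + y)
  add⇓ x y = prec⇓ (loop x)
    where
    loop : ∀ x → PrecL (proj 0) (comp succ [ proj 1 ]) f x [ y ] (x + y)
    loop zero = prec-zero⇓ (proj⇓ 0 refl)
    loop (suc x) = prec-suc⇓ (loop x) (comp⇓ (cons⇓ (proj⇓ 1 refl) nil⇓) succ⇓)

  monus⇓ : ∀ y x → Eval monusCode f (y ∷ x ∷ []) (x ∸ y)
  monus⇓ y x = prec⇓ (loop y)
    where
    loop : ∀ y → PrecL (proj 0) (comp predCode [ proj 1 ]) f y [ x ] (x ∸ y)
    loop zero = prec-zero⇓ (proj⇓ 0 refl)
    loop (suc y) = subst (PrecL _ _ f (suc y) [ x ]) (pred[m∸n]≡m∸[1+n] x y)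
      (prec-suc⇓ (loop y) (comp⇓ (cons⇓ (proj⇓ 1 refl) nil⇓) (pred⇓ (x ∸ y))))

Least : (ℕ → Set) → ℕ → Set
Least P n = P n × (∀ m → m < n → ¬ P m)

least-unique : ∀ {P m n} → Least P m → Least P n → m ≡ n
least-unique {m = m} {n} (pm , m-least) (pn , n-least) with <-cmp m n
... | tri< m<n _ _ = ⊥-elim (n-least m m<n pm)
... | tri≈ _ m≡n _ = m≡n
... | tri> _ _ n<m = ⊥-elim (m-least n n<m pn)

least : ∀ {P} → Decidable P → ∀ {k} → P k → ∃ (Least P)
least {P} P? {k} pk = scan 0 k (λ _ ()) pk
  where
  scan : ∀ i j → (∀ m → m < i → ¬ P m) → P (i + j) → ∃ (Least P)
  scan i j below p with P? i
  ... | yes pi = i , pi , below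
  scan i zero below p | no ¬pi = ⊥-elim (¬pi (subst P (+-identityʳ i) p))
  scan i (suc j) below p | no ¬pi = scan (suc i) j below' (subst P (+-suc i j) p)
    where
    below' : ∀ m → m < suc i → ¬ P m
    below' m (s≤s m≤i) with m≤n⇒m<n∨m≡n m≤i
    ... | inj₁ m<i = below m m<i
    ... | inj₂ refl = ¬pi

-- v codes n when half v ≡ n; the bit carried by v is then v ∸ (n + n).
record Codes (n v : ℕ) : Set where
  constructor codes
  field
    lower : n + n ≤ v
    upper : v ≤ suc (n + n)

codes? : ∀ n → Decidable (Codes n)
codes? n v = map′ (λ (l , u) → codes l u) (λ (codes l u) → l , u) ((n + n ≤? v) ×-dec (v ≤? suc (n + n)))

codes-≤ : ∀ {n v} → Codes n v → n ≤ v
codes-≤ {n} (codes n+n≤v _) = ≤-trans (m≤m+n n n) n+n≤v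

codes-bit≤1 : ∀ {n v} → Codes n v → v ∸ (n + n) ≤ 1
codes-bit≤1 {n} {v} (codes _ v≤1+n+n) = m≤n+o⇒m∸n≤o v (n + n) (subst (v ≤_) (+-comm 1 (n + n)) v≤1+n+n)

codeTest : ℕ → ℕ → ℕ
codeTest n v = (v ∸ suc (n + n)) + ((n + n) ∸ v)

codeTest-codes : ∀ {n v} → Codes n v → codeTest n v ≡ 0
codeTest-codes (codes n+n≤v v≤1+n+n) rewrite m≤n⇒m∸n≡0 v≤1+n+n | m≤n⇒m∸n≡0 n+n≤v = refl

codeTest-¬codes : ∀ {n v} → ¬ Codes n v → codeTest n v ≢ 0
codeTest-¬codes {n} {v} ¬codes test≡0 =
  ¬codes (codes (m∸n≡0⇒m≤n (m+n≡0⇒n≡0 (v ∸ suc (n + n)) test≡0)) (m∸n≡0⇒m≤n (m+n≡0⇒m≡0 _ test≡0)))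

FirstCode : (ℕ → ℕ) → ℕ → ℕ → Set
FirstCode f n = Least (λ p → Codes n (f p))

queryCode doubleCode codeTestCode outputCode decoder : Code
queryCode = comp orc [ proj 0 ]
doubleCode = comp addCode (proj 1 ∷ proj 1 ∷ [])
codeTestCode = comp addCode
  (comp monusCode (comp succ [ doubleCode ] ∷ queryCode ∷ []) ∷ comp monusCode (queryCode ∷ doubleCode ∷ []) ∷ [])
outputCode = comp monusCode (doubleCode ∷ queryCode ∷ [])
decoder = comp outputCode (mu codeTestCode ∷ proj 0 ∷ [])

module _ {f : ℕ → ℕ} where

  query⇓ : ∀ i n → Eval queryCode f (i ∷ n ∷ []) (f i)
  query⇓ i n = comp⇓ (cons⇓ (proj⇓ 0 refl) nil⇓) orc⇓

  double⇓ : ∀ i n → Eval doubleCode f (i ∷ n ∷ []) (n + n)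
  double⇓ i n = comp⇓ (cons⇓ (proj⇓ 1 refl) (cons⇓ (proj⇓ 1 refl) nil⇓)) (add⇓ n n)

  codeTest⇓ : ∀ n i → Eval codeTestCode f (i ∷ n ∷ []) (codeTest n (f i))
  codeTest⇓ n i = comp⇓
    (cons⇓ (comp⇓ (cons⇓ (comp⇓ (cons⇓ (double⇓ i n) nil⇓) succ⇓) (cons⇓ (query⇓ i n) nil⇓)) (monus⇓ _ _))
    (cons⇓ (comp⇓ (cons⇓ (query⇓ i n) (cons⇓ (double⇓ i n) nil⇓)) (monus⇓ _ _)) nil⇓))
    (add⇓ _ _)

  decoder⇓ : ∀ {n L} → FirstCode f n L → Eval decoder f [ n ] (f L ∸ (n + n))
  decoder⇓ {n} {L} (hit , below) = comp⇓
    (cons⇓ (search⇓ (λ i → codeTest n (f i)) (codeTest⇓ n) L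
             (λ p p<L → codeTest-¬codes (below p p<L)) (codeTest-codes hit))
      (cons⇓ (proj⇓ 0 refl) nil⇓))
    (comp⇓ (cons⇓ (double⇓ L n) (cons⇓ (query⇓ L n) nil⇓)) (monus⇓ _ _))

≤tri : ∀ d → d ≤ tri d
≤tri zero = z≤n
≤tri (suc d) = m≤m+n (suc d) (tri d)

tri-mono-≤ : ∀ {a b} → a ≤ b → tri a ≤ tri b
tri-mono-≤ {b = zero} z≤n = ≤-refl
tri-mono-≤ {b = suc b} a≤1+b with m≤n⇒m<n∨m≡n a≤1+b
... | inj₁ (s≤s a≤b) = ≤-trans (tri-mono-≤ a≤b) (m≤n+m (tri b) (suc b))
... | inj₂ refl = ≤-refl

m≤⟨m,n⟩ : ∀ m n → m ≤ ⟨ m , n ⟩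
m≤⟨m,n⟩ m n = ≤-trans (m≤m+n m n) (≤-trans (≤tri (m + n)) (m≤m+n (tri (m + n)) n))

-- The pairs on a diagonal m + n ≡ d are coded in [tri d, tri d + d], below tri (suc d).
⟨,⟩-diagonal-< : ∀ m n m' n' → m + n < m' + n' → ⟨ m , n ⟩ < ⟨ m' , n' ⟩
⟨,⟩-diagonal-< m n m' n' lt = begin-strict
    tri (m + n) + n        ≤⟨ +-monoʳ-≤ (tri (m + n)) (m≤n+m n m) ⟩
    tri (m + n) + (m + n)  <⟨ subst (_< suc (m + n) + tri (m + n)) (+-comm (m + n) (tri (m + n))) (n<1+n _) ⟩
    tri (suc (m + n))      ≤⟨ tri-mono-≤ lt ⟩
    tri (m' + n')          ≤⟨ m≤m+n _ n' ⟩
    tri (m' + n') + n'     ∎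
  where open ≤-Reasoning

⟨,⟩-injective : ∀ {m n m' n'} → ⟨ m , n ⟩ ≡ ⟨ m' , n' ⟩ → m ≡ m' × n ≡ n'
⟨,⟩-injective {m} {n} {m'} {n'} eq with <-cmp (m + n) (m' + n')
... | tri< lt _ _ = ⊥-elim (<-irrefl eq (⟨,⟩-diagonal-< m n m' n' lt))
... | tri> _ _ gt = ⊥-elim (<-irrefl (sym eq) (⟨,⟩-diagonal-< m' n' m n gt))
... | tri≈ _ same _ = m≡m' , n≡n'
  where
  n≡n' : n ≡ n'
  n≡n' = +-cancelˡ-≡ (tri (m + n)) n n' (trans eq (cong (λ d → tri d + n') (sym same)))
  m≡m' : m ≡ m'
  m≡m' = +-cancelʳ-≡ n m m' (trans same (cong (m' +_) (sym n≡n')))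

half-≤ : ∀ x → half x ≤ x
half-≤ zero = z≤n
half-≤ (suc zero) = z≤n
half-≤ (suc (suc x)) = s≤s (≤-trans (half-≤ x) (n≤1+n x))

half-< : ∀ x → 0 < half x → half x < x
half-< (suc (suc x)) _ = s≤s (s≤s (half-≤ x))

∈D⇒< : ∀ {i x} → i ∈D x → i < x
∈D⇒< {zero} {suc x} _ = z<s
∈D⇒< {suc i} {x} i∈x = ≤-<-trans i<half (half-< x (≤-<-trans z≤n i<half))
  where
  i<half : i < half x
  i<half = ∈D⇒< {i} {half x} i∈x

data Tree : Set where
  node : ℕ → ℕ → List Tree → Tree

mutual
  toTree : Code → Tree
  toTree zer = node 0 0 []
  toTree succ = node 1 0 []
  toTree (proj i) = node 2 i []
  toTree (comp c ds) = node 3 0 (toTree c ∷ toTrees ds)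
  toTree (prec b s) = node 4 0 (toTree b ∷ toTree s ∷ [])
  toTree (mu c) = node 5 0 [ toTree c ]
  toTree orc = node 6 0 []

  toTrees : List Code → List Tree
  toTrees [] = []
  toTrees (d ∷ ds) = toTree d ∷ toTrees ds

mutual
  fromTree : Tree → Code
  fromTree (node 1 _ _) = succ
  fromTree (node 2 i _) = proj i
  fromTree (node 3 _ (c ∷ ds)) = comp (fromTree c) (fromTrees ds)
  fromTree (node 4 _ (b ∷ s ∷ _)) = prec (fromTree b) (fromTree s)
  fromTree (node 5 _ (c ∷ _)) = mu (fromTree c)
  fromTree (node 6 _ _) = orc
  fromTree _ = zer

  fromTrees : List Tree → List Code
  fromTrees [] = []
  fromTrees (t ∷ ts) = fromTree t ∷ fromTrees ts

mutual
  fromTree-toTree : ∀ c → fromTree (toTree c) ≡ c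
  fromTree-toTree zer = refl
  fromTree-toTree succ = refl
  fromTree-toTree (proj i) = refl
  fromTree-toTree (comp c ds) = cong₂ comp (fromTree-toTree c) (fromTrees-toTrees ds)
  fromTree-toTree (prec b s) = cong₂ prec (fromTree-toTree b) (fromTree-toTree s)
  fromTree-toTree (mu c) = cong mu (fromTree-toTree c)
  fromTree-toTree orc = refl

  fromTrees-toTrees : ∀ ds → fromTrees (toTrees ds) ≡ ds
  fromTrees-toTrees [] = refl
  fromTrees-toTrees (d ∷ ds) = cong₂ _∷_ (fromTree-toTree d) (fromTrees-toTrees ds)

mutual
  treeCode : Tree → ℕ
  treeCode (node a i ts) = ⟨ a , ⟨ i , treesCode ts ⟩ ⟩

  treesCode : List Tree → ℕ
  treesCode [] = 0
  treesCode (t ∷ ts) = suc ⟨ treeCode t , treesCode ts ⟩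

mutual
  treeCode-injective : ∀ t t' → treeCode t ≡ treeCode t' → t ≡ t'
  treeCode-injective (node a i ts) (node a' i' ts') eq
    with refl , eq₁ ← ⟨,⟩-injective {a} {_} {a'} eq
    with refl , eq₂ ← ⟨,⟩-injective {i} {_} {i'} eq₁ =
    cong (node a i) (treesCode-injective ts ts' eq₂)

  treesCode-injective : ∀ ts ts' → treesCode ts ≡ treesCode ts' → ts ≡ ts'
  treesCode-injective [] [] _ = refl
  treesCode-injective (t ∷ ts) (t' ∷ ts') eq
    with eq₁ , eq₂ ← ⟨,⟩-injective {treeCode t} {_} {treeCode t'} (suc-injective eq) =
    cong₂ _∷_ (treeCode-injective t t' eq₁) (treesCode-injective ts ts' eq₂)

code# : Code → ℕ
code# c = treeCode (toTree c)

code#-injective : ∀ {c c'} → code# c ≡ code# c' → c ≡ c'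
code#-injective {c} {c'} eq = begin
  c                    ≡⟨ sym (fromTree-toTree c) ⟩
  fromTree (toTree c)  ≡⟨ cong fromTree (treeCode-injective (toTree c) (toTree c') eq) ⟩
  fromTree (toTree c') ≡⟨ fromTree-toTree c' ⟩
  c'                   ∎
  where open ≡-Reasoning

record Segment : Set where
  constructor segment
  field
    len : ℕ
    at  : ℕ → ℕ
open Segment

_⊑_ : Segment → Segment → Set
σ ⊑ τ = len σ ≤ len τ × (∀ p → p < len σ → at τ p ≡ at σ p)

⊑-refl : ∀ {σ} → σ ⊑ σ
⊑-refl = ≤-refl , λ _ _ → refl

⊑-trans : ∀ {ρ σ τ} → ρ ⊑ σ → σ ⊑ τ → ρ ⊑ τ
⊑-trans (ρ≤σ , σ≗ρ) (σ≤τ , τ≗σ) = ≤-trans ρ≤σ σ≤τ , λ p p<ρ → trans (τ≗σ p (≤-trans p<ρ ρ≤σ)) (σ≗ρ p p<ρ)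

Prefix : Segment → (ℕ → ℕ) → Set
Prefix σ g = ∀ p → p < len σ → g p ≡ at σ p

prefix-⊑ : ∀ {σ τ g} → σ ⊑ τ → Prefix τ g → Prefix σ g
prefix-⊑ (σ≤τ , τ≗σ) τ≺g p p<σ = trans (τ≺g p (≤-trans p<σ σ≤τ)) (τ≗σ p p<σ)

Decodes : (ℕ → ℕ) → (ℕ → ℕ) → Set
Decodes g h = ∀ n L → FirstCode g n L → h n ≡ g L ∸ (n + n)

Forces : ∀ {ℓ} → Segment → ((ℕ → ℕ) → (ℕ → ℕ) → Set ℓ) → Set ℓ
Forces σ P = ∀ g h → Prefix σ g → Decodes g h → P g h

forces-⊑ : ∀ {ℓ σ τ} {P : (ℕ → ℕ) → (ℕ → ℕ) → Set ℓ} → σ ⊑ τ → Forces σ P → Forces τ P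
forces-⊑ σ⊑τ σ⊩P g h τ≺g = σ⊩P g h (prefix-⊑ σ⊑τ τ≺g)

maxBelow : (ℕ → ℕ) → ℕ → ℕ
maxBelow f zero = 0
maxBelow f (suc N) = f N ⊔ maxBelow f N

≤maxBelow : ∀ f {N p} → p < N → f p ≤ maxBelow f N
≤maxBelow f {suc N} (s≤s p≤N) with m≤n⇒m<n∨m≡n p≤N
... | inj₁ p<N = ≤-trans (≤maxBelow f p<N) (m≤n⊔m (f N) _)
... | inj₂ refl = m≤m⊔n (f N) _

codes-beyond : ∀ f {N n p} → maxBelow f N < n → Codes n (f p) → N ≤ p
codes-beyond f {N} {n} {p} fresh fp-codes with N ≤? p
... | yes N≤p = N≤p
... | no N≰p = ⊥-elim (<-irrefl refl (<-≤-trans fresh (≤-trans (codes-≤ fp-codes) (≤maxBelow f (≰⇒> N≰p)))))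

fresh : ∀ f N M → ∃[ n ] (maxBelow f N < n × M ≤ n)
fresh f N M = suc (maxBelow f N + M) , s≤s (m≤m+n _ M) , ≤-trans (m≤n+m M _) (n≤1+n _)

update : (ℕ → ℕ) → ℕ → ℕ → ℕ → ℕ
update u L v p with p ≟ L
... | yes _ = v
... | no _ = u p

update-here : ∀ u L v → update u L v L ≡ v
update-here u L v with L ≟ L
... | yes _ = refl
... | no L≢L = ⊥-elim (L≢L refl)

update-there : ∀ u {L v p} → p ≢ L → update u L v p ≡ u p
update-there u {L} {v} {p} p≢L with p ≟ L
... | yes p≡L = ⊥-elim (p≢L p≡L)
... | no _ = refl

otherBit : ℕ → ℕ
otherBit zero = 1
otherBit (suc _) = 0

otherBit≤1 : ∀ b → otherBit b ≤ 1
otherBit≤1 zero = ≤-refl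
otherBit≤1 (suc _) = z≤n

otherBit-≢ : ∀ b → b ≢ otherBit b
otherBit-≢ zero ()
otherBit-≢ (suc b) ()

-- Follow u up to x + len σ, except that position len σ gets a code for n carrying the bit other than b.
plant : Segment → (ℕ → ℕ) → (n b x : ℕ) → Segment
plant σ u n b x = segment (suc (x + len σ)) (update u (len σ) (otherBit b + (n + n)))

module _ {σ : Segment} {u : ℕ → ℕ} (u≗σ : ∀ p → p < len σ → u p ≡ at σ p) (n b x : ℕ) where

  ⊑-plant : σ ⊑ plant σ u n b x
  ⊑-plant = ≤-trans (m≤n+m (len σ) x) (n≤1+n _) , λ p p<σ → trans (update-there u (<⇒≢ p<σ)) (u≗σ p p<σ)

  plant-agrees : ∀ {g p} → Prefix (plant σ u n b x) g → p ≤ x + len σ → p ≢ len σ → g p ≡ u p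
  plant-agrees plant≺g p≤ p≢σ = trans (plant≺g _ (s≤s p≤)) (update-there u p≢σ)

  plant-forces-≢ : maxBelow (at σ) (len σ) < n → Forces (plant σ u n b x) (λ g h → h n ≢ b)
  plant-forces-≢ n-fresh g h plant≺g g↦h h≡b = otherBit-≢ b (begin
    b                           ≡⟨ sym h≡b ⟩
    h n                         ≡⟨ g↦h n (len σ) (codes-gL , before) ⟩
    g (len σ) ∸ (n + n)         ≡⟨ cong (_∸ (n + n)) gL ⟩
    otherBit b + (n + n) ∸ (n + n) ≡⟨ m+n∸n≡m (otherBit b) (n + n) ⟩
    otherBit b                  ∎)
    where
    open ≡-Reasoning
    gL : g (len σ) ≡ otherBit b + (n + n)
    gL = trans (plant≺g _ (s≤s (m≤n+m _ x))) (update-here u (len σ) _)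
    codes-gL : Codes n (g (len σ))
    codes-gL = subst (Codes n) (sym gL) (codes (m≤n+m (n + n) (otherBit b)) (+-monoˡ-≤ (n + n) (otherBit≤1 b)))
    before : ∀ p → p < len σ → ¬ Codes n (g p)
    before p p<σ gp-codes = <⇒≱ p<σ (codes-beyond (at σ) n-fresh
      (subst (Codes n) (trans (plant-agrees plant≺g (≤-trans (<⇒≤ p<σ) (m≤n+m _ x)) (<⇒≢ p<σ)) (u≗σ p p<σ)) gp-codes))

CofiniteVia : Code → (ℕ → ℕ) → (ℕ → ℕ) → Set₁
CofiniteVia W h g = ∀ (D : ℕ → Set) → Cofinite D →
  ∃[ D' ] (Cofinite D' × (∀ k → EnumOp W (GraphOn g D) k ⇔ GraphOn h D' k))

UbfbVia : Code → (ℕ → ℕ) → (ℕ → ℕ) → Set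
UbfbVia Φ h g = (∀ n → Φ ^ g ⟨ n ⟩≃ h n) ×
  (∀ M → ∃[ N ] (∀ n → N ≤ n → ∀ m qs → RunsTo Φ g n m qs → All (M ≤_) qs))

cofinite-≢ : ∀ L → Cofinite (_≢ L)
cofinite-≢ L = suc L , λ n L<n n≡L → <⇒≢ L<n (sym n≡L)

graphOn-agree : ∀ {u g D x i} → (∀ p → p < x → D p → g p ≡ u p) → GraphOn u D i → i < x → GraphOn g D i
graphOn-agree {u} agree (p , Dp , refl) ⟨p,up⟩<x =
  p , Dp , cong (λ v → ⟨ p , v ⟩) (sym (agree p (≤-<-trans (m≤⟨m,n⟩ p (u p)) ⟨p,up⟩<x) Dp))

appendCodes : ℕ → Segment → Segment
appendCodes e σ = segment (len σ + suc e) table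
  where
  table : ℕ → ℕ
  table p with p <? len σ
  ... | yes _ = at σ p
  ... | no _ = (p ∸ len σ) + (p ∸ len σ)

⊑-appendCodes : ∀ {e σ} → σ ⊑ appendCodes e σ
⊑-appendCodes {e} {σ} = m≤m+n (len σ) (suc e) , below
  where
  below : ∀ p → p < len σ → at (appendCodes e σ) p ≡ at σ p
  below p p<σ with p <? len σ
  ... | yes _ = refl
  ... | no p≮σ = ⊥-elim (p≮σ p<σ)

appendCodes-covers : ∀ {e ρ σ} → ρ ⊑ σ → ∀ n → n ≤ e →
  ∃[ p ] (len ρ ≤ p × p < len (appendCodes e σ) × at (appendCodes e σ) p ≡ n + n)
appendCodes-covers {e} {ρ} {σ} (ρ≤σ , _) n n≤e =
  len σ + n , ≤-trans ρ≤σ (m≤m+n (len σ) n) , +-monoʳ-< (len σ) (s≤s n≤e) , codes-there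
  where
  codes-there : at (appendCodes e σ) (len σ + n) ≡ n + n
  codes-there with len σ + n <? len σ
  ... | yes σ+n<σ = ⊥-elim (<-irrefl refl (<-≤-trans σ+n<σ (m≤m+n (len σ) n)))
  ... | no _ rewrite m+n∸m≡n (len σ) n = refl

codes-double : ∀ n → Codes n (n + n)
codes-double n = codes ≤-refl (n≤1+n _)

χ-bit : ∀ {C : ℕ → Bool} {n v} → v ≤ 1 → C n ≡ (v ≡ᵇ 1) → χ C n ≡ v
χ-bit {C} {n} v≤1 C≡ with C n
χ-bit {v = zero} _ refl | false = refl
χ-bit {v = suc zero} _ refl | true = refl
χ-bit {v = suc (suc _)} (s≤s ()) _ | _

firstCode-transfer : ∀ {f g N n L} → (∀ p → N ≤ p → f p ≡ g p) →
  maxBelow f N < n → maxBelow g N < n → FirstCode f n L → FirstCode g n L × f L ≡ g L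
firstCode-transfer {f} {g} {n = n} f≗g f-fresh g-fresh (hit , below) =
  (subst (Codes n) fL≡gL hit , λ p p<L gp → below p p<L (subst (Codes n) (sym (f≗g p (codes-beyond g g-fresh gp))) gp))
  , fL≡gL
  where
  fL≡gL = f≗g _ (codes-beyond f f-fresh hit)

module Construction (lem : ExcludedMiddle 0ℓ) where

  CfWitness : Code → Segment → Set
  CfWitness W σ = ∃[ u ] ∃[ n ] ∃[ b ] ((∀ p → p < len σ → u p ≡ at σ p) ×
    maxBelow (at σ) (len σ) < n × EnumOp W (GraphOn u (_≢ len σ)) ⟨ n , b ⟩)

  cf-step : ∀ W σ → ∃[ τ ] (σ ⊑ τ × Forces τ (λ g h → ¬ CofiniteVia W h g))
  cf-step W σ with lem {CfWitness W σ}
  ... | yes (u , n , b , u≗σ , n-fresh , x , x∈W , x⊆graph) = plant σ u n b x , ⊑-plant u≗σ n b x , defeat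
    where
    defeat : Forces (plant σ u n b x) (λ g h → ¬ CofiniteVia W h g)
    defeat g h plant≺g g↦h via with D' , _ , W≡graph ← via (_≢ len σ) (cofinite-≢ (len σ))
      with n' , _ , eq ← Equivalence.to (W≡graph ⟨ n , b ⟩) (x , x∈W , λ i i∈x →
        graphOn-agree (λ p p<x → plant-agrees u≗σ n b x plant≺g (≤-trans (<⇒≤ p<x) (m≤m+n x _)))
                      (x⊆graph i i∈x) (∈D⇒< i∈x))
      with refl , b≡hn ← ⟨,⟩-injective {n} {b} {n'} {h n'} eq =
      plant-forces-≢ u≗σ n b x n-fresh g h plant≺g g↦h (sym b≡hn)
  ... | no ¬witness = σ , ⊑-refl , defeat
    where
    -- The description missing len σ makes W enumerate some ⟨ n , h n ⟩ with n fresh: a witness.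
    defeat : Forces σ (λ g h → ¬ CofiniteVia W h g)
    defeat g h σ≺g _ via with D' , (N , D'-cofinite) , W≡graph ← via (_≢ len σ) (cofinite-≢ (len σ))
      with n , n-fresh , N≤n ← fresh (at σ) (len σ) N =
      ¬witness (g , n , h n , σ≺g , n-fresh , Equivalence.from (W≡graph ⟨ n , h n ⟩) (n , D'-cofinite n N≤n , refl))

  UbfbWitness : Code → Segment → Set
  UbfbWitness Φ σ = ∃[ u ] ∃[ n ] ∃[ b ] ∃[ k ] ∃[ qs ] ((∀ p → p < len σ → u p ≡ at σ p) ×
    maxBelow (at σ) (len σ) < n × eval k Φ u [ n ] ≡ just (b , qs) × All (len σ <_) qs)

  ubfb-step : ∀ Φ σ → ∃[ τ ] (σ ⊑ τ × Forces τ (λ g h → ¬ UbfbVia Φ h g))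
  ubfb-step Φ σ with lem {UbfbWitness Φ σ}
  ... | yes (u , n , b , k , qs , u≗σ , n-fresh , Φu , qs>σ) = plant σ u n b (max 0 qs) , ⊑-plant u≗σ n b _ , defeat
    where
    defeat : Forces (plant σ u n b (max 0 qs)) (λ g h → ¬ UbfbVia Φ h g)
    defeat g h plant≺g g↦h (computes , _) with qs' , k' , Φg ← computes n =
      plant-forces-≢ u≗σ n b _ n-fresh g h plant≺g g↦h
        (sym (cong proj₁ (eval-deterministic {k} {k'} Φ g [ n ] (eval-use {k} Φ u g [ n ] u≗g Φu) Φg)))
      where
      u≗g : AgreeOn u g qs
      u≗g = All.zipWith (λ (σ<q , q≤max) → sym (plant-agrees u≗σ n b _ plant≺g (≤-trans q≤max (m≤m+n _ _)) (>⇒≢ σ<q)))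
              (qs>σ , xs≤max 0 qs)
  ... | no ¬witness = σ , ⊑-refl , defeat
    where
    defeat : Forces σ (λ g h → ¬ UbfbVia Φ h g)
    defeat g h σ≺g _ (computes , bounded) with N , beyond ← bounded (suc (len σ))
      with n , n-fresh , N≤n ← fresh (at σ) (len σ) N with qs , k , Φg ← computes n =
      ¬witness (g , n , h n , k , qs , σ≺g , n-fresh , Φg , beyond n N≤n (h n) qs (k , Φg))

  record StageSpec (e : ℕ) (σ τ : Segment) : Set₁ where
    field
      extends      : σ ⊑ τ
      defeats-cf   : ∀ W → code# W ≡ e → Forces τ (λ g h → ¬ CofiniteVia W h g)
      defeats-ubfb : ∀ W → code# W ≡ e → Forces τ (λ g h → ¬ UbfbVia W h g)
      covers       : ∀ n → n ≤ e → ∃[ p ] (len σ ≤ p × p < len τ × at τ p ≡ n + n)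
  open StageSpec

  stage : ∀ e σ → Σ Segment (StageSpec e σ)
  stage e σ with lem {∃[ W ] code# W ≡ e}
  ... | no ∄W = appendCodes e σ , record
    { extends      = ⊑-appendCodes
    ; defeats-cf   = λ W W# → ⊥-elim (∄W (W , W#))
    ; defeats-ubfb = λ W W# → ⊥-elim (∄W (W , W#))
    ; covers       = appendCodes-covers ⊑-refl
    }
  ... | yes (W , W#)
    with τ₁ , σ⊑τ₁ , τ₁⊩¬cf ← cf-step W σ
    with τ₂ , τ₁⊑τ₂ , τ₂⊩¬ubfb ← ubfb-step W τ₁ = appendCodes e τ₂ , record
    { extends      = ⊑-trans σ⊑τ₂ ⊑-appendCodes
    ; defeats-cf   = λ W' W'# → subst (λ V → Forces _ (λ g h → ¬ CofiniteVia V h g)) (same W'#)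
                       (forces-⊑ (⊑-trans τ₁⊑τ₂ ⊑-appendCodes) τ₁⊩¬cf)
    ; defeats-ubfb = λ W' W'# → subst (λ V → Forces _ (λ g h → ¬ UbfbVia V h g)) (same W'#)
                       (forces-⊑ ⊑-appendCodes τ₂⊩¬ubfb)
    ; covers       = appendCodes-covers σ⊑τ₂
    }
    where
    σ⊑τ₂ = ⊑-trans σ⊑τ₁ τ₁⊑τ₂
    same : ∀ {W'} → code# W' ≡ e → W ≡ W'
    same W'# = code#-injective (trans W# (sym W'#))

  stateAt : ℕ → Segment
  stateAt zero = segment 0 (λ _ → 0)
  stateAt (suc e) = proj₁ (stage e (stateAt e))

  stageAt : ∀ e → StageSpec e (stateAt e) (stateAt (suc e))
  stageAt e = proj₂ (stage e (stateAt e))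

  len-grows : ∀ e → e ≤ len (stateAt e)
  len-grows zero = z≤n
  len-grows (suc e) with p , σ≤p , p<τ , _ ← covers (stageAt e) 0 z≤n = ≤-trans (s≤s (≤-trans (len-grows e) σ≤p)) p<τ

  stateAt-⊑ : ∀ {e e'} → e ≤ e' → stateAt e ⊑ stateAt e'
  stateAt-⊑ {e' = zero} z≤n = ⊑-refl
  stateAt-⊑ {e' = suc e'} e≤1+e' with m≤n⇒m<n∨m≡n e≤1+e'
  ... | inj₁ (s≤s e≤e') = ⊑-trans (stateAt-⊑ e≤e') (extends (stageAt e'))
  ... | inj₂ refl = ⊑-refl

  G : ℕ → ℕ
  G p = at (stateAt (suc p)) p

  prefix-G : ∀ e → Prefix (stateAt e) G
  prefix-G e p p<e with ≤-total (suc p) e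
  ... | inj₁ 1+p≤e = sym (proj₂ (stateAt-⊑ 1+p≤e) p (len-grows (suc p)))
  ... | inj₂ e≤1+p = proj₂ (stateAt-⊑ e≤1+p) p p<e

  G-codes-beyond : ∀ n N → ∃[ p ] (N ≤ p × G p ≡ n + n)
  G-codes-beyond n N with p , σ≤p , p<τ , τp ← covers (stageAt (n + N)) n (m≤m+n n N) =
    p , ≤-trans (≤-trans (m≤n+m N n) (len-grows (n + N))) σ≤p , trans (prefix-G (suc (n + N)) p p<τ) τp

  firstCode-modFin : ∀ {f} → ModFinDesc f G → ∀ n → ∃ (FirstCode f n)
  firstCode-modFin {f} (N , f≗G) n with p , N≤p , Gp ← G-codes-beyond n N =
    least (λ p → codes? n (f p)) (subst (Codes n) (sym (trans (f≗G p N≤p) Gp)) (codes-double n))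

  G-firstCode : ∀ n → ∃ (FirstCode G n)
  G-firstCode = firstCode-modFin (0 , λ _ _ → refl)

  B : ℕ → Bool
  B n = G (proj₁ (G-firstCode n)) ∸ (n + n) ≡ᵇ 1

  G-decodes-B : Decodes G (χ B)
  G-decodes-B n L first = begin
    χ B n          ≡⟨ χ-bit {B} {n} (codes-bit≤1 (proj₁ first₀)) refl ⟩
    G L₀ ∸ (n + n) ≡⟨ cong (λ p → G p ∸ (n + n)) (least-unique first₀ first) ⟩
    G L ∸ (n + n)  ∎
    where
    open ≡-Reasoning
    L₀ = proj₁ (G-firstCode n)
    first₀ = proj₂ (G-firstCode n)

  B≤mfG : χ B ≤mf G
  B≤mfG = decoder , λ f f~G → (λ n → _ , eval⇒computes (decoder⇓ (proj₂ (firstCode-modFin f~G n))))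
                             , correct f f~G
    where
    correct : ∀ f → ModFinDesc f G → ∃[ N ] (∀ n → N ≤ n → decoder ^ f ⟨ n ⟩≃ χ B n)
    correct f f~G@(N₀ , f≗G) = suc (maxBelow f N₀ + maxBelow G N₀) , λ n N≤n →
      let L , firstf = firstCode-modFin f~G n
          firstG , fL≡GL = firstCode-transfer f≗G (<-≤-trans (s≤s (m≤m+n _ _)) N≤n)
                                                  (<-≤-trans (s≤s (m≤n+m _ _)) N≤n) firstf
      in subst (decoder ^ f ⟨ n ⟩≃_) (trans (cong (_∸ (n + n)) fL≡GL) (sym (G-decodes-B n L firstG)))
           (eval⇒computes (decoder⇓ firstf))

  B≰cfG : ¬ (χ B ≤cf G)
  B≰cfG (W , via) = defeats-cf (stageAt (code# W)) W refl G (χ B) (prefix-G (suc (code# W))) G-decodes-B via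

  B≰ubfbG : ¬ (χ B ≤ubfb G)
  B≰ubfbG (Φ , via) = defeats-ubfb (stageAt (code# Φ)) Φ refl G (χ B) (prefix-G (suc (code# Φ))) G-decodes-B via

proposition4p3 : ExcludedMiddle 0ℓ →
    ∃[ g ] ∃[ B ] ((χ B ≤mf g) × (¬ (χ B ≤cf g)) × (¬ (χ B ≤ubfb g)))
proposition4p3 lem = G , B , B≤mfG , B≰cfG , B≰ubfbG
  where open Construction lem
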